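{- Let $k\ge4$ be an integer. Then every $k$-ring contains a hole of length $k$.
   Context: All graphs are finite and simple. A hole is an induced cycle on at least four vertices; its length is its number of vertices. A $k$-ring ($k\ge4$) is a graph $R$ whose vertex set can be partitioned into nonempty sets $X_0,\dots,X_{k-1}$ (indices in $\mathbb{Z}_k$) such that for each $i$, $X_i$ can be ordered as $u^i_1,\dots,u^i_{|X_i|}$ so that $X_i\subseteq N_R[u^i_{|X_i|}]\subseteq\dots\subseteq N_R[u^i_1]=X_{i-1}\cup X_i\cup X_{i+1}$, where $N_R[v]$ is the closed neighborhood of $v$. -}

module Defs where

open import Data.Nat using (ℕ; zero; suc; _≤_)
open import Data.Nat.DivMod using (_mod_)
open import Data.Fin using (Fin; zero; suc; toℕ; inject₁; fromℕ)
open import Data.Product using (Σ; ∃; _×_; _,_)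
open import Data.Sum using (_⊎_)
open import Data.Empty using (⊥)
open import Relation.Nullary using (¬_)
open import Relation.Binary.PropositionalEquality using (_≡_)
open import Function.Definitions using (Injective)

record Graph (n : ℕ) : Set₁ where
  field
    Adj     : Fin n → Fin n → Set
    sym     : ∀ {u v} → Adj u v → Adj v u
    irrefl  : ∀ {u} → ¬ Adj u u
open Graph public

_∈N[_]_ : ∀ {n} → Fin n → Fin n → Graph n → Set
w ∈N[ v ] G = w ≡ v ⊎ Adj G v w

NSub : ∀ {n} → Graph n → Fin n → Fin n → Set
NSub G a b = ∀ w → w ∈N[ a ] G → w ∈N[ b ] G

next : ∀ {k} → Fin k → Fin k
next {suc k} i = suc (toℕ i) mod suc k

prev : ∀ {k} → Fin k → Fin k
prev {suc k} i = (toℕ i Data.Nat.+ k) mod suc k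

-- A k-ring structure on G: a partition of V(G) into nonempty parts X_0..X_{k-1}
-- (part : V → Fin k assigns each vertex its part), where each X_i is ordered as
-- u^i_1,...,u^i_{m_i} (here ord i : Fin (suc (len i)) → Fin n, a bijection onto X_i,
-- with u^i_1 = ord i zero and u^i_{m_i} = ord i (fromℕ (len i))), such that
--   X_i ⊆ N[u^i_{m_i}] ⊆ ... ⊆ N[u^i_1] = X_{i-1} ∪ X_i ∪ X_{i+1}.
record Ring {n : ℕ} (G : Graph n) (k : ℕ) : Set where
  field
    part     : Fin n → Fin k
    len      : Fin k → ℕ     -- |X_i| = suc (len i) ≥ 1 (nonempty)
    ord      : (i : Fin k) → Fin (suc (len i)) → Fin n
    ord-inj  : ∀ i → Injective _≡_ _≡_ (ord i)
    ord-part : ∀ i j → part (ord i j) ≡ i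
    ord-onto : ∀ i v → part v ≡ i → ∃ λ j → ord i j ≡ v
    last-cov : ∀ i v → part v ≡ i → v ∈N[ ord i (fromℕ (len i)) ] G
    chain    : ∀ i (j : Fin (len i)) → NSub G (ord i (suc j)) (ord i (inject₁ j))
    first-N  : ∀ i w → w ∈N[ ord i zero ] G
                 → (part w ≡ prev i ⊎ part w ≡ i ⊎ part w ≡ next i)
    first-N' : ∀ i w → (part w ≡ prev i ⊎ part w ≡ i ⊎ part w ≡ next i)
                 → w ∈N[ ord i zero ] G

IsRing : ∀ {n} → Graph n → ℕ → Set
IsRing G k = Ring G k

HasHoleOfLength : ∀ {n} → Graph n → ℕ → Set
HasHoleOfLength {n} G k =
  Σ (Fin k → Fin n) λ c →
    Injective _≡_ _≡_ c ×
    (∀ i j → Adj G (c i) (c j) → (j ≡ next i ⊎ i ≡ next j)) ×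
    (∀ i j → (j ≡ next i ⊎ i ≡ next j) → Adj G (c i) (c j))

{-# OPTIONS --safe #-}
module Submission where

open import Defs hiding (sym)
open import Data.Nat using (ℕ; zero; suc; _+_; _%_; _≤_; s≤s; NonZero)
open import Data.Nat.Properties using (+-suc; 0≢1+n; 1+n≢n; suc-injective; m≤n⇒m<n∨m≡n)
open import Data.Nat.DivMod using (%-distribˡ-+; m%n%n≡m%n; [m+n]%n≡m%n; m<n⇒m%n≡m; n%n≡0)
open import Data.Fin using (Fin; toℕ; zero)
open import Data.Fin.Properties using (toℕ-fromℕ<; toℕ-injective; toℕ<n)
open import Data.Product using (_,_)
open import Data.Sum using (_⊎_; inj₁; inj₂)
open import Data.Empty using (⊥-elim)
open import Relation.Binary.PropositionalEquality
  using (_≡_; _≢_; sym; trans; cong; subst; module ≡-Reasoning)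

-- Take the first vertex u^i_1 of every part. Since N[u^i_1] = X_{i-1} ∪ X_i ∪ X_{i+1}
-- and the parts are disjoint, u^i_1 and u^j_1 are adjacent exactly when j = i ± 1,
-- so u^0_1 u^1_1 … u^{k-1}_1 is an induced cycle.

toℕ-next : ∀ {m} (i : Fin (suc m)) → toℕ (next i) ≡ suc (toℕ i) % suc m
toℕ-next i = toℕ-fromℕ< _

toℕ-prev : ∀ {m} (i : Fin (suc m)) → toℕ (prev i) ≡ (toℕ i + m) % suc m
toℕ-prev i = toℕ-fromℕ< _

[1+m%d]%d≡[1+m]%d : ∀ m d .{{_ : NonZero d}} → suc (m % d) % d ≡ suc m % d
[1+m%d]%d≡[1+m]%d m d = begin
  (1 + m % d) % d              ≡⟨ %-distribˡ-+ 1 (m % d) d ⟩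
  (1 % d + m % d % d) % d      ≡⟨ cong (λ x → (1 % d + x) % d) (m%n%n≡m%n m d) ⟩
  (1 % d + m % d) % d          ≡⟨ %-distribˡ-+ 1 m d ⟨
  (1 + m) % d                  ∎
  where open ≡-Reasoning

next-prev : ∀ {k} (i : Fin k) → next (prev i) ≡ i
next-prev {suc m} i = toℕ-injective (begin
  toℕ (next (prev i))           ≡⟨ toℕ-next (prev i) ⟩
  suc (toℕ (prev i)) % suc m    ≡⟨ cong (λ x → suc x % suc m) (toℕ-prev i) ⟩
  suc ((t + m) % suc m) % suc m ≡⟨ [1+m%d]%d≡[1+m]%d (t + m) (suc m) ⟩
  suc (t + m) % suc m           ≡⟨ cong (_% suc m) (+-suc t m) ⟨
  (t + suc m) % suc m           ≡⟨ [m+n]%n≡m%n t (suc m) ⟩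
  t % suc m                     ≡⟨ m<n⇒m%n≡m (toℕ<n i) ⟩
  t                             ∎)
  where
  open ≡-Reasoning
  t = toℕ i

-- Fails for k = 1; this is where a ring needs at least two parts.
next-≢ : ∀ {m} (i : Fin (suc (suc m))) → i ≢ next i
next-≢ {m} i i≡next with m≤n⇒m<n∨m≡n (toℕ<n i)
... | inj₁ 1+i<k = 1+n≢n (trans (sym (m<n⇒m%n≡m 1+i<k)) toℕ[next]≡i)
  where toℕ[next]≡i = trans (sym (toℕ-next i)) (cong toℕ (sym i≡next))
... | inj₂ 1+i≡k = 0≢1+n (begin
  0                            ≡⟨ n%n≡0 (suc (suc m)) ⟨
  suc (suc m) % suc (suc m)    ≡⟨ cong (_% suc (suc m)) 1+i≡k ⟨
  suc (toℕ i) % suc (suc m)    ≡⟨ toℕ-next i ⟨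
  toℕ (next i)                 ≡⟨ cong toℕ i≡next ⟨
  toℕ i                        ≡⟨ suc-injective 1+i≡k ⟩
  suc m                        ∎)
  where open ≡-Reasoning

Consecutive : ∀ {k} → Fin k → Fin k → Set
Consecutive i j = j ≡ next i ⊎ i ≡ next j

module FirstVertices {n k : ℕ} {G : Graph n} (R : Ring G k) where
  open Ring R

  first : Fin k → Fin n
  first i = ord i zero

  part-first : ∀ i → part (first i) ≡ i
  part-first i = ord-part i zero

  first-injective : ∀ {i j} → first i ≡ first j → i ≡ j
  first-injective {i} {j} eq =
    trans (sym (part-first i)) (trans (cong part eq) (part-first j))

  first-adj⇒consecutive : ∀ i j → Adj G (first i) (first j) → Consecutive i j
  first-adj⇒consecutive i j adj with first-N i (first j) (inj₂ adj)
  ... | inj₁ part≡prev = inj₂ (begin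
    i                     ≡⟨ next-prev i ⟨
    next (prev i)         ≡⟨ cong next part≡prev ⟨
    next (part (first j)) ≡⟨ cong next (part-first j) ⟩
    next j                ∎)
    where open ≡-Reasoning
  ... | inj₂ (inj₁ part≡i) = ⊥-elim (irrefl G (subst (λ x → Adj G (first i) (first x)) j≡i adj))
    where j≡i = trans (sym (part-first j)) part≡i
  ... | inj₂ (inj₂ part≡next) = inj₁ (trans (sym (part-first j)) part≡next)

  next⇒first-adj : (∀ i → i ≢ next i) → ∀ i j → j ≡ next i → Adj G (first i) (first j)
  next⇒first-adj i≢next i j j≡next
    with first-N' i (first j) (inj₂ (inj₂ (trans (part-first j) j≡next)))
  ... | inj₁ same = ⊥-elim (i≢next i (trans (sym (first-injective same)) j≡next))
  ... | inj₂ adj  = adj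

  consecutive⇒first-adj : (∀ i → i ≢ next i) → ∀ i j → Consecutive i j → Adj G (first i) (first j)
  consecutive⇒first-adj i≢next i j (inj₁ j≡next) = next⇒first-adj i≢next i j j≡next
  consecutive⇒first-adj i≢next i j (inj₂ i≡next) = Graph.sym G (next⇒first-adj i≢next j i i≡next)

ring⇒hole : ∀ {n m} {G : Graph n} → Ring G (suc (suc m)) → HasHoleOfLength G (suc (suc m))
ring⇒hole R = first , first-injective , first-adj⇒consecutive , consecutive⇒first-adj next-≢
  where open FirstVertices R

proposition6p4 : (k : ℕ) → 4 ≤ k → (n : ℕ) (G : Graph n) → IsRing G k → HasHoleOfLength G k
proposition6p4 (suc (suc m)) (s≤s (s≤s _)) n G R = ring⇒hole R
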